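{- The skew characteristic polynomial of simple graphs is a $4$-invariant: for every finite simple graph $G$ and every pair of distinct vertices $a,b\in V(G)$, $$Q_G-Q_{G'_{ab}}=Q_{\widetilde G_{ab}}-Q_{\widetilde G'_{ab}}.$$
   Context: For a finite simple graph $G$: $A_G$ is the adjacency matrix over $\mathbb{F}_2$; the nondegeneracy $\nu(G)\in\{0,1\}$ is $1$ iff $A_G$ is invertible over $\mathbb{F}_2$, with $\nu(\text{empty graph})=1$; $G(U)$ is the induced subgraph on $U\subseteq V(G)$; $Q_G(u)=\sum_{k\ge0}q_k(G)u^{|V(G)|-k}$ with $q_k(G)=\sum_{U\subseteq V(G),|U|=k}\nu(G(U))$. For distinct vertices $a,b$: $G'_{ab}$ is obtained from $G$ by deleting the edge $ab$ if it exists and adding it otherwise; $\widetilde G_{ab}$ is obtained from $G$ by switching, for every vertex $c\notin\{a,b\}$ adjacent to $b$, the adjacency between $c$ and $a$ (other adjacencies unchanged); $\widetilde G'_{ab}=(\widetilde G_{ab})'_{ab}=\widetilde{(G'_{ab})}_{ab}$. -}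

module Defs where

open import Data.Bool using (Bool; true; false; not; _∧_; _∨_; _xor_; if_then_else_)
open import Data.Nat using (ℕ; zero; suc; _∸_; _≡ᵇ_; _≤ᵇ_)
open import Data.Fin using (Fin; zero; suc; punchIn; _≟_)
open import Data.Fin.Subset using (Subset; ∣_∣)
open import Data.List using (List; []; _∷_; map; foldr; length; lookup; _++_; allFin)
open import Data.Nat.ListAction using (sum)
open import Data.Vec using ([]; _∷_)
open import Data.Integer using (ℤ; +_)
open import Relation.Nullary.Decidable using (⌊_⌋)

-- A finite simple graph on vertex set Fin n is given by its adjacency
-- matrix over F₂ = Bool (xor = +, ∧ = ·); simplicity (symmetry,
-- irreflexivity) is imposed as hypotheses in the statement.
AdjMat : ℕ → Set
AdjMat n = Fin n → Fin n → Bool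

-- Determinant over F₂ by Laplace expansion along the first row
-- (signs are irrelevant in characteristic 2); det of the 0×0 matrix is 1.
det : ∀ {m} → (Fin m → Fin m → Bool) → Bool
det {zero}  M = true
det {suc m} M =
  foldr _xor_ false
    (map (λ j → M zero j ∧ det (λ i k → M (suc i) (punchIn j k))) (allFin (suc m)))

allSubsets : (n : ℕ) → List (Subset n)
allSubsets zero    = [] ∷ []
allSubsets (suc n) =
  map (true ∷_) (allSubsets n) ++ map (false ∷_) (allSubsets n)

members : ∀ {n} → Subset n → List (Fin n)
members []          = []
members (true ∷ p)  = zero ∷ map suc (members p)
members (false ∷ p) = map suc (members p)

induced : ∀ {n} → AdjMat n → (U : Subset n) →
          Fin (length (members U)) → Fin (length (members U)) → Bool
induced A U i j = A (lookup (members U) i) (lookup (members U) j)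

-- Nondegeneracy ν(G(U)) ∈ {0,1}: 1 iff the adjacency matrix is invertible over F₂,
-- i.e. iff its determinant over F₂ is 1.
ν : ∀ {n} → AdjMat n → Subset n → ℕ
ν A U = if det (induced A U) then 1 else 0

q : ∀ {n} → AdjMat n → ℕ → ℕ
q {n} A k = sum (map (λ U → if ∣ U ∣ ≡ᵇ k then ν A U else 0) (allSubsets n))

-- Q_G(u) = Σ_k q_k(G) u^{n-k}, represented by its coefficient function:
-- Qcoeff A j = coefficient of u^j (an integer polynomial).
Qcoeff : ∀ {n} → AdjMat n → ℕ → ℤ
Qcoeff {n} A j = if j ≤ᵇ n then + q A (n ∸ j) else + 0

flipEdge : ∀ {n} → AdjMat n → Fin n → Fin n → AdjMat n
flipEdge A a b x y =
  if (⌊ x ≟ a ⌋ ∧ ⌊ y ≟ b ⌋) ∨ (⌊ x ≟ b ⌋ ∧ ⌊ y ≟ a ⌋)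
  then not (A x y) else A x y

-- G̃_{ab}: for every c ∉ {a,b} adjacent to b, switch the adjacency between c and a.
tilde : ∀ {n} → AdjMat n → Fin n → Fin n → AdjMat n
tilde A a b x y =
  if ⌊ x ≟ a ⌋ ∧ not ⌊ y ≟ a ⌋ ∧ not ⌊ y ≟ b ⌋ then A x y xor A b y
  else if ⌊ y ≟ a ⌋ ∧ not ⌊ x ≟ a ⌋ ∧ not ⌊ x ≟ b ⌋ then A x y xor A x b
  else A x y

tildeFlip : ∀ {n} → AdjMat n → Fin n → Fin n → AdjMat n
tildeFlip A a b = flipEdge (tilde A a b) a b

-- For U ⊆ V(G) compare the four induced subgraphs on U. If a ∉ U or b ∉ U, toggling
-- the edge ab does not touch them, so ν(G(U)) = ν(G'(U)) and ν(G̃(U)) = ν(G̃'(U)).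
-- If a, b ∈ U, the adjacency matrix of G̃(U) is obtained from that of G(U) by adding
-- column b to column a and then row b to row a (the entries at (a,a), (a,b), (b,a)
-- come out right because A_ab = A_ba and A_bb = 0), so the two have the same
-- determinant over F₂; since switching commutes with toggling ab, also
-- ν(G̃'(U)) = ν(G'(U)). In both cases ν(G(U)) + ν(G̃'(U)) = ν(G'(U)) + ν(G̃(U)), and
-- summing over all U of a fixed size gives the identity coefficientwise.
module Submission where

open import Defs
open import Algebra.Bundles using (CommutativeRing; CommutativeMonoid)
import Algebra.Properties.CommutativeSemigroup as CommutativeSemigroupProperties
open import Data.Bool using (Bool; true; false; not; _∧_; _∨_; _xor_; if_then_else_)
open import Data.Bool.Properties
  using (xor-∧-commutativeRing; ∧-commutativeMonoid; ∧-zeroʳ; xor-identityʳ; ∧-distribˡ-xor; ∧-distribʳ-xor)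
open import Data.Empty using (⊥-elim)
open import Data.Fin using (Fin; suc; punchIn; _≟_)
open import Data.Fin.Patterns using (0F; 1F)
open import Data.Fin.Permutation as Perm using (Permutation; _⟨$⟩ʳ_; remove; punchIn-permute)
import Data.Fin.Permutation.Components as PC
open import Data.Fin.Properties using (suc-injective)
open import Data.Fin.Subset using (Subset; ∣_∣)
open import Data.Integer using (+_; _-_; _⊖_)
open import Data.Integer.Properties using ([+m]-[+n]≡m⊖n; +-cancelˡ-⊖)
open import Data.List using (List; []; _∷_; foldr; map; tabulate; lookup)
open import Data.List.Membership.Propositional using (_∈_; _∉_)
open import Data.List.Membership.Propositional.Properties using (∈-lookup)
open import Data.List.Properties using (map-cong; map-tabulate)
import Data.List.Relation.Unary.All as All
import Data.List.Relation.Unary.All.Properties as All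
open import Data.List.Relation.Unary.AllPairs using ([]; _∷_)
open import Data.List.Relation.Unary.Any using (index; any?)
open import Data.List.Relation.Unary.Any.Properties using (lookup-index)
open import Data.List.Relation.Unary.Unique.Propositional using (Unique)
import Data.List.Relation.Unary.Unique.Propositional.Properties as Unique
open import Data.Maybe using (Maybe; just; nothing)
open import Data.Nat using (ℕ; zero; suc; _+_; _∸_; _≤ᵇ_; _≡ᵇ_)
open import Data.Nat.ListAction using (sum)
open import Data.Nat.Properties using (+-comm; +-commutativeSemigroup)
open import Data.Product using (∃; _×_; _,_)
open import Data.Sum as Sum using (_⊎_; inj₁; inj₂)
open import Data.Vec using ([]; _∷_)
open import Function using (id; _∘_)
open import Function.Bundles using (Injection)
open import Function.Definitions using (Injective)
open import Function.Properties.Inverse using (↔⇒↣)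
open import Relation.Binary.PropositionalEquality
open import Relation.Nullary using (yes; no)
open import Relation.Nullary.Decidable using (⌊_⌋; dec-false)
open import Tactic.RingSolver using (solve-∀)
open import Tactic.RingSolver.Core.AlmostCommutativeRing using (AlmostCommutativeRing; fromCommutativeRing)

open CommutativeRing xor-∧-commutativeRing using (semiring; +-commutativeMonoid)
open import Algebra.Properties.Semiring.Sum semiring
  using (sum-syntax; sum-cong-≗; sum-permute; ∑-distrib-+; ∑-comm; *-distribˡ-sum)
module XorProperties = CommutativeSemigroupProperties (CommutativeMonoid.commutativeSemigroup +-commutativeMonoid)
module ∧Properties = CommutativeSemigroupProperties (CommutativeMonoid.commutativeSemigroup ∧-commutativeMonoid)
module ℕ+Properties = CommutativeSemigroupProperties +-commutativeSemigroup

private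
  variable
    m n : ℕ

-- The zero test lets the solver cancel coefficients 1 + 1 = 0.
𝔽₂ : AlmostCommutativeRing _ _
𝔽₂ = fromCommutativeRing xor-∧-commutativeRing isFalse
  where
  isFalse : ∀ x → Maybe (false ≡ x)
  isFalse false = just refl
  isFalse true  = nothing

≟-refl : (x : Fin n) → ⌊ x ≟ x ⌋ ≡ true
≟-refl x with x ≟ x
... | yes _  = refl
... | no x≢x = ⊥-elim (x≢x refl)

≟-≢ : {x y : Fin n} → x ≢ y → ⌊ x ≟ y ⌋ ≡ false
≟-≢ {x = x} {y} x≢y with x ≟ y
... | yes x≡y = ⊥-elim (x≢y x≡y)
... | no _    = refl

≟-injective : {u : Fin m → Fin n} → Injective _≡_ _≡_ u → ∀ i j → ⌊ u i ≟ u j ⌋ ≡ ⌊ i ≟ j ⌋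
≟-injective {u = u} u-inj i j with i ≟ j
... | yes refl = ≟-refl (u i)
... | no i≢j   = ≟-≢ (i≢j ∘ u-inj)

-- Determinants over F₂

minor : Fin (suc m) → AdjMat (suc m) → AdjMat m
minor j M i k = M (suc i) (punchIn j k)

foldr-xor-tabulate : (f : Fin m → Bool) → foldr _xor_ false (tabulate f) ≡ ∑[ i < m ] f i
foldr-xor-tabulate {zero}  f = refl
foldr-xor-tabulate {suc m} f = cong (f 0F xor_) (foldr-xor-tabulate (f ∘ suc))

det-expand : (M : AdjMat (suc m)) → det M ≡ ∑[ j < suc m ] (M 0F j ∧ det (minor j M))
det-expand M = trans (cong (foldr _xor_ false) (map-tabulate id term)) (foldr-xor-tabulate term)
  where
  term : Fin _ → Bool
  term j = M 0F j ∧ det (minor j M)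

det-cong : {M N : AdjMat m} → (∀ i j → M i j ≡ N i j) → det M ≡ det N
det-cong {zero}          M≗N = refl
det-cong {suc m} {M} {N} M≗N = begin
  det M                                      ≡⟨ det-expand M ⟩
  ∑[ j < suc m ] (M 0F j ∧ det (minor j M))  ≡⟨ sum-cong-≗ (λ j → cong₂ _∧_ (M≗N 0F j) (det-cong (λ i k → M≗N (suc i) (punchIn j k)))) ⟩
  ∑[ j < suc m ] (N 0F j ∧ det (minor j N))  ≡⟨ det-expand N ⟨
  det N                                      ∎
  where open ≡-Reasoning

det-permuteColumns : (M : AdjMat m) (π : Permutation m m) → det (λ i j → M i (π ⟨$⟩ʳ j)) ≡ det M
det-permuteColumns {zero}  M π = refl
det-permuteColumns {suc m} M π = begin
  det Mπ                                                       ≡⟨ det-expand Mπ ⟩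
  ∑[ j < suc m ] (M 0F (π ⟨$⟩ʳ j) ∧ det (minor j Mπ))          ≡⟨ sum-cong-≗ (λ j → cong (M 0F (π ⟨$⟩ʳ j) ∧_) (minor-permute j)) ⟩
  ∑[ j < suc m ] (M 0F (π ⟨$⟩ʳ j) ∧ det (minor (π ⟨$⟩ʳ j) M))  ≡⟨ sum-permute (λ k → M 0F k ∧ det (minor k M)) π ⟨
  ∑[ k < suc m ] (M 0F k ∧ det (minor k M))                    ≡⟨ det-expand M ⟨
  det M                                                        ∎
  where
  open ≡-Reasoning
  Mπ : AdjMat (suc m)
  Mπ i j = M i (π ⟨$⟩ʳ j)
  minor-permute : ∀ j → det (minor j Mπ) ≡ det (minor (π ⟨$⟩ʳ j) M)
  minor-permute j = trans (det-cong (λ i k → cong (M (suc i)) (punchIn-permute π j k)))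
                          (det-permuteColumns (minor (π ⟨$⟩ʳ j) M) (remove j π))

det-linear-column₀ : (M N P : AdjMat (suc m)) →
  (∀ i → P i 0F ≡ M i 0F xor N i 0F) →
  (∀ i j → P i (suc j) ≡ M i (suc j)) → (∀ i j → N i (suc j) ≡ M i (suc j)) →
  det P ≡ det M xor det N
minor-linear-column₀ : (M N P : AdjMat (suc m)) →
  (∀ i → P i 0F ≡ M i 0F xor N i 0F) →
  (∀ i j → P i (suc j) ≡ M i (suc j)) → (∀ i j → N i (suc j) ≡ M i (suc j)) →
  ∀ j → det (minor (suc j) P) ≡ det (minor (suc j) M) xor det (minor (suc j) N)

det-linear-column₀ {m} M N P P₀≡M₀+N₀ P≗M N≗M = begin
  det P
    ≡⟨ det-expand P ⟩
  (P 0F 0F ∧ det (minor 0F P)) xor ∑[ j < m ] (P 0F (suc j) ∧ det (minor (suc j) P))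
    ≡⟨ cong₂ _xor_ first-term other-terms ⟩
  ((M 0F 0F ∧ d₀) xor (N 0F 0F ∧ d₀)) xor (∑[ j < m ] Mⱼ j xor ∑[ j < m ] Nⱼ j)
    ≡⟨ XorProperties.interchange (M 0F 0F ∧ d₀) (N 0F 0F ∧ d₀) (∑[ j < m ] Mⱼ j) (∑[ j < m ] Nⱼ j) ⟩
  ((M 0F 0F ∧ d₀) xor ∑[ j < m ] Mⱼ j) xor ((N 0F 0F ∧ d₀) xor ∑[ j < m ] Nⱼ j)
    ≡⟨ cong₂ _xor_ (det-expand M) (trans (det-expand N) (cong (λ d → (N 0F 0F ∧ d) xor ∑[ j < m ] Nⱼ j) minor₀N≡d₀)) ⟨
  det M xor det N
    ∎
  where
  open ≡-Reasoning
  d₀ = det (minor 0F M)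
  minor₀N≡d₀ : det (minor 0F N) ≡ d₀
  minor₀N≡d₀ = det-cong (N≗M ∘ suc)
  Mⱼ Nⱼ : Fin m → Bool
  Mⱼ j = M 0F (suc j) ∧ det (minor (suc j) M)
  Nⱼ j = N 0F (suc j) ∧ det (minor (suc j) N)
  first-term : P 0F 0F ∧ det (minor 0F P) ≡ (M 0F 0F ∧ d₀) xor (N 0F 0F ∧ d₀)
  first-term = trans (cong₂ _∧_ (P₀≡M₀+N₀ 0F) (det-cong (P≗M ∘ suc)))
                     (∧-distribʳ-xor d₀ (M 0F 0F) (N 0F 0F))
  other-term : ∀ j → P 0F (suc j) ∧ det (minor (suc j) P) ≡ Mⱼ j xor Nⱼ j
  other-term j = begin
    P 0F (suc j) ∧ det (minor (suc j) P)
      ≡⟨ cong₂ _∧_ (P≗M 0F j) (minor-linear-column₀ M N P P₀≡M₀+N₀ P≗M N≗M j) ⟩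
    M 0F (suc j) ∧ (det (minor (suc j) M) xor det (minor (suc j) N))
      ≡⟨ ∧-distribˡ-xor (M 0F (suc j)) _ _ ⟩
    Mⱼ j xor (M 0F (suc j) ∧ det (minor (suc j) N))
      ≡⟨ cong (λ x → Mⱼ j xor (x ∧ det (minor (suc j) N))) (N≗M 0F j) ⟨
    Mⱼ j xor Nⱼ j
      ∎
  other-terms : ∑[ j < m ] (P 0F (suc j) ∧ det (minor (suc j) P)) ≡ ∑[ j < m ] Mⱼ j xor ∑[ j < m ] Nⱼ j
  other-terms = trans (sum-cong-≗ other-term) (∑-distrib-+ Mⱼ Nⱼ)

minor-linear-column₀ {suc m} M N P P₀≡M₀+N₀ P≗M N≗M j =
  det-linear-column₀ (minor (suc j) M) (minor (suc j) N) (minor (suc j) P)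
    (P₀≡M₀+N₀ ∘ suc) (λ i k → P≗M (suc i) (punchIn j k)) (λ i k → N≗M (suc i) (punchIn j k))

addColumn : AdjMat m → Fin m → Fin m → AdjMat m
addColumn M p q i j = if ⌊ j ≟ p ⌋ then M i j xor M i q else M i j

det-addColumn₀₁ : (M : AdjMat (suc (suc m))) → det (addColumn M 0F 1F) ≡ det M
minor-addColumn₀₁ : (M : AdjMat (suc (suc m))) (j : Fin m) →
  det (minor (suc (suc j)) (addColumn M 0F 1F)) ≡ det (minor (suc (suc j)) M)

det-addColumn₀₁ {m} M = begin
  det K
    ≡⟨ det-expand K ⟩
  ((M₀₀ xor M₀₁) ∧ d₀) xor ((M₀₁ ∧ det (minor 1F K)) xor ∑[ j < m ] Kⱼ j)
    ≡⟨ cong₂ (λ x y → ((M₀₀ xor M₀₁) ∧ d₀) xor ((M₀₁ ∧ x) xor y)) minor₁K (sum-cong-≗ Kⱼ≡Mⱼ) ⟩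
  ((M₀₀ xor M₀₁) ∧ d₀) xor ((M₀₁ ∧ (d₁ xor d₀)) xor ∑[ j < m ] Mⱼ j)
    ≡⟨ cancel M₀₀ M₀₁ d₀ d₁ (∑[ j < m ] Mⱼ j) ⟩
  (M₀₀ ∧ d₀) xor ((M₀₁ ∧ d₁) xor ∑[ j < m ] Mⱼ j)
    ≡⟨ det-expand M ⟨
  det M
    ∎
  where
  open ≡-Reasoning
  K = addColumn M 0F 1F
  M₀₀ = M 0F 0F
  M₀₁ = M 0F 1F
  d₀ = det (minor 0F M)
  d₁ = det (minor 1F M)
  Kⱼ Mⱼ : Fin m → Bool
  Kⱼ j = M 0F (suc (suc j)) ∧ det (minor (suc (suc j)) K)
  Mⱼ j = M 0F (suc (suc j)) ∧ det (minor (suc (suc j)) M)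
  minor₁K : det (minor 1F K) ≡ d₁ xor d₀
  minor₁K = det-linear-column₀ (minor 1F M) (minor 0F M) (minor 1F K) (λ _ → refl) (λ _ _ → refl) (λ _ _ → refl)
  Kⱼ≡Mⱼ : ∀ j → Kⱼ j ≡ Mⱼ j
  Kⱼ≡Mⱼ j = cong (M 0F (suc (suc j)) ∧_) (minor-addColumn₀₁ M j)
  cancel : ∀ a b x y z → ((a xor b) ∧ x) xor ((b ∧ (y xor x)) xor z) ≡ (a ∧ x) xor ((b ∧ y) xor z)
  cancel = solve-∀ 𝔽₂

minor-addColumn₀₁ {suc m} M j = trans (det-cong minor-addColumn) (det-addColumn₀₁ (minor (suc (suc j)) M))
  where
  minor-addColumn : ∀ i k → minor (suc (suc j)) (addColumn M 0F 1F) i k ≡ addColumn (minor (suc (suc j)) M) 0F 1F i k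
  minor-addColumn i 0F      = refl
  minor-addColumn i (suc k) = refl

-- Composition ∘ₚ is diagrammatic: π k = (0 p) ((1 r) k), with r = (p 0) q ≠ 0 as q ≠ p.
permutation-mapping₀₁ : {p q : Fin (suc (suc n))} → p ≢ q →
  ∃ λ (π : Permutation (suc (suc n)) (suc (suc n))) → π ⟨$⟩ʳ 0F ≡ p × π ⟨$⟩ʳ 1F ≡ q
permutation-mapping₀₁ {p = p} {q} p≢q =
  Perm.transpose 1F r Perm.∘ₚ Perm.transpose 0F p , π0≡p , PC.transpose-inverse 0F p
  where
  r = PC.transpose p 0F q
  r≢0 : r ≢ 0F
  r≢0 r≡0 = p≢q (trans (cong (PC.transpose 0F p) (sym r≡0)) (PC.transpose-inverse 0F p))
  π0≡p : PC.transpose 0F p (PC.transpose 1F r 0F) ≡ p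
  π0≡p rewrite dec-false (0F ≟ r) (r≢0 ∘ sym) = refl

addColumn-permute : (M : AdjMat m) (π : Permutation m m) (p q : Fin m) → ∀ i j →
  addColumn M (π ⟨$⟩ʳ p) (π ⟨$⟩ʳ q) i (π ⟨$⟩ʳ j) ≡ addColumn (λ i j → M i (π ⟨$⟩ʳ j)) p q i j
addColumn-permute M π p q i j rewrite ≟-injective (Injection.injective (↔⇒↣ π)) j p = refl

det-addColumn : (M : AdjMat m) {p q : Fin m} → p ≢ q → det (addColumn M p q) ≡ det M
det-addColumn {suc zero}    M {0F} {0F} p≢q = ⊥-elim (p≢q refl)
det-addColumn {suc (suc m)} M p≢q with permutation-mapping₀₁ p≢q
... | π , refl , refl = begin
  det (addColumn M (π ⟨$⟩ʳ 0F) (π ⟨$⟩ʳ 1F))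
    ≡⟨ det-permuteColumns (addColumn M (π ⟨$⟩ʳ 0F) (π ⟨$⟩ʳ 1F)) π ⟨
  det (λ i j → addColumn M (π ⟨$⟩ʳ 0F) (π ⟨$⟩ʳ 1F) i (π ⟨$⟩ʳ j))
    ≡⟨ det-cong (addColumn-permute M π 0F 1F) ⟩
  det (addColumn Mπ 0F 1F)
    ≡⟨ det-addColumn₀₁ Mπ ⟩
  det Mπ
    ≡⟨ det-permuteColumns M π ⟩
  det M
    ∎
  where
  open ≡-Reasoning
  Mπ : AdjMat (suc (suc m))
  Mπ i j = M i (π ⟨$⟩ʳ j)

det-expand-column₀ : (M : AdjMat (suc m)) →
  det M ≡ ∑[ i < suc m ] (M i 0F ∧ det (λ r c → M (punchIn i r) (suc c)))
det-expand-column₀ {zero}  M = det-expand M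
det-expand-column₀ {suc m} M = trans (det-expand M) (cong ((M 0F 0F ∧ det (minor 0F M)) xor_) (begin
  ∑[ j < suc m ] (M 0F (suc j) ∧ det (minor (suc j) M))
    ≡⟨ sum-cong-≗ (λ j → cong (M 0F (suc j) ∧_) (det-expand-column₀ (minor (suc j) M))) ⟩
  ∑[ j < suc m ] (M 0F (suc j) ∧ ∑[ i < suc m ] (M (suc i) 0F ∧ E i j))
    ≡⟨ sum-cong-≗ (λ j → *-distribˡ-sum (M 0F (suc j)) (λ i → M (suc i) 0F ∧ E i j)) ⟩
  ∑[ j < suc m ] ∑[ i < suc m ] (M 0F (suc j) ∧ (M (suc i) 0F ∧ E i j))
    ≡⟨ ∑-comm (λ j i → M 0F (suc j) ∧ (M (suc i) 0F ∧ E i j)) ⟩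
  ∑[ i < suc m ] ∑[ j < suc m ] (M 0F (suc j) ∧ (M (suc i) 0F ∧ E i j))
    ≡⟨ sum-cong-≗ (λ i → sum-cong-≗ (λ j → ∧Properties.x∙yz≈y∙xz (M 0F (suc j)) (M (suc i) 0F) (E i j))) ⟩
  ∑[ i < suc m ] ∑[ j < suc m ] (M (suc i) 0F ∧ (M 0F (suc j) ∧ E i j))
    ≡⟨ sum-cong-≗ (λ i → *-distribˡ-sum (M (suc i) 0F) (λ j → M 0F (suc j) ∧ E i j)) ⟨
  ∑[ i < suc m ] (M (suc i) 0F ∧ ∑[ j < suc m ] (M 0F (suc j) ∧ E i j))
    ≡⟨ sum-cong-≗ (λ i → cong (M (suc i) 0F ∧_) (det-expand (λ r c → M (punchIn (suc i) r) (suc c)))) ⟨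
  ∑[ i < suc m ] (M (suc i) 0F ∧ det (λ r c → M (punchIn (suc i) r) (suc c)))
    ∎))
  where
  open ≡-Reasoning
  E : Fin (suc m) → Fin (suc m) → Bool
  E i j = det (λ r c → M (suc (punchIn i r)) (suc (punchIn j c)))

infix 10 _ᵀ
_ᵀ : AdjMat m → AdjMat m
(M ᵀ) i j = M j i

det-transpose : (M : AdjMat m) → det (M ᵀ) ≡ det M
det-transpose {zero}  M = refl
det-transpose {suc m} M = begin
  det (M ᵀ)
    ≡⟨ det-expand (M ᵀ) ⟩
  ∑[ i < suc m ] (M i 0F ∧ det ((λ r c → M (punchIn i r) (suc c)) ᵀ))
    ≡⟨ sum-cong-≗ (λ i → cong (M i 0F ∧_) (det-transpose (λ r c → M (punchIn i r) (suc c)))) ⟩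
  ∑[ i < suc m ] (M i 0F ∧ det (λ r c → M (punchIn i r) (suc c)))
    ≡⟨ det-expand-column₀ M ⟨
  det M
    ∎
  where open ≡-Reasoning

addRow : AdjMat m → Fin m → Fin m → AdjMat m
addRow M p q = (addColumn (M ᵀ) p q) ᵀ

det-addRow : (M : AdjMat m) {p q : Fin m} → p ≢ q → det (addRow M p q) ≡ det M
det-addRow M {p} {q} p≢q = begin
  det ((addColumn (M ᵀ) p q) ᵀ) ≡⟨ det-transpose (addColumn (M ᵀ) p q) ⟩
  det (addColumn (M ᵀ) p q)      ≡⟨ det-addColumn (M ᵀ) p≢q ⟩
  det (M ᵀ)                      ≡⟨ det-transpose M ⟩
  det M                          ∎
  where open ≡-Reasoning

-- Switching and toggling an edge

tilde≗addRow-addColumn : (M : AdjMat m) {p q : Fin m} → M p q ≡ M q p → M q q ≡ false →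
  ∀ i j → tilde M p q i j ≡ addRow (addColumn M p q) p q i j
tilde≗addRow-addColumn M {p} {q} Mpq≡Mqp Mqq≡0 i j with i ≟ p | j ≟ p | i ≟ q | j ≟ q
... | yes refl | yes refl | _        | _        rewrite Mpq≡Mqp | Mqq≡0 = sym (cancel (M p p) (M q p))
  where
  cancel : ∀ x y → (x xor y) xor (y xor false) ≡ x
  cancel = solve-∀ 𝔽₂
... | yes refl | no _     | _        | yes refl rewrite Mqq≡0 = sym (xor-identityʳ (M p q))
... | yes refl | no _     | _        | no _     = refl
... | no _     | yes refl | yes refl | _        rewrite Mqq≡0 = sym (xor-identityʳ (M q p))
... | no _     | yes refl | no _     | _        = refl
... | no _     | no _     | _        | _        = refl

det-tilde : (M : AdjMat m) {p q : Fin m} → M p q ≡ M q p → M q q ≡ false → p ≢ q →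
  det (tilde M p q) ≡ det M
det-tilde M {p} {q} Mpq≡Mqp Mqq≡0 p≢q = begin
  det (tilde M p q)                   ≡⟨ det-cong (tilde≗addRow-addColumn M Mpq≡Mqp Mqq≡0) ⟩
  det (addRow (addColumn M p q) p q)  ≡⟨ det-addRow (addColumn M p q) p≢q ⟩
  det (addColumn M p q)               ≡⟨ det-addColumn M p≢q ⟩
  det M                               ∎
  where open ≡-Reasoning

tilde-flipEdge : (M : AdjMat m) {p q : Fin m} → p ≢ q →
  ∀ i j → tilde (flipEdge M p q) p q i j ≡ tildeFlip M p q i j
tilde-flipEdge M {p} {q} p≢q i j rewrite ≟-refl q | ≟-≢ (p≢q ∘ sym) with i ≟ p | j ≟ p | i ≟ q | j ≟ q
... | yes refl | yes refl | _        | _        = refl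
... | yes refl | no _     | yes refl | _        = ⊥-elim (p≢q refl)
... | yes refl | no _     | no _     | yes refl = refl
... | yes refl | no _     | no _     | no _     = refl
... | no _     | yes refl | yes refl | _        = refl
... | no _     | yes refl | no _     | _        = refl
... | no _     | no _     | _        | _        = refl

det-tildeFlip : (M : AdjMat m) {p q : Fin m} → M p q ≡ M q p → M q q ≡ false → p ≢ q →
  det (tildeFlip M p q) ≡ det (flipEdge M p q)
det-tildeFlip M {p} {q} Mpq≡Mqp Mqq≡0 p≢q =
  trans (sym (det-cong (tilde-flipEdge M p≢q))) (det-tilde (flipEdge M p q) Fpq≡Fqp Fqq≡0 p≢q)
  where
  Fpq≡Fqp : flipEdge M p q p q ≡ flipEdge M p q q p
  Fpq≡Fqp rewrite ≟-refl p | ≟-refl q | ≟-≢ p≢q | ≟-≢ (p≢q ∘ sym) = cong not Mpq≡Mqp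
  Fqq≡0 : flipEdge M p q q q ≡ false
  Fqq≡0 rewrite ≟-refl q | ≟-≢ (p≢q ∘ sym) = Mqq≡0

flipEdge-cong : {X Y : AdjMat n} (a b : Fin n) → (∀ x y → X x y ≡ Y x y) →
  ∀ x y → flipEdge X a b x y ≡ flipEdge Y a b x y
flipEdge-cong a b X≗Y x y =
  cong (λ z → if (⌊ x ≟ a ⌋ ∧ ⌊ y ≟ b ⌋) ∨ (⌊ x ≟ b ⌋ ∧ ⌊ y ≟ a ⌋) then not z else z) (X≗Y x y)

≟∧≟-false : {x a y b : Fin n} → x ≢ a ⊎ y ≢ b → ⌊ x ≟ a ⌋ ∧ ⌊ y ≟ b ⌋ ≡ false
≟∧≟-false {y = y} {b} (inj₁ x≢a) = cong (_∧ ⌊ y ≟ b ⌋) (≟-≢ x≢a)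
≟∧≟-false {x = x} {a} (inj₂ y≢b) = trans (cong (⌊ x ≟ a ⌋ ∧_) (≟-≢ y≢b)) (∧-zeroʳ ⌊ x ≟ a ⌋)

flipEdge-apart : (X : AdjMat n) {a b x y : Fin n} → x ≢ a ⊎ y ≢ b → x ≢ b ⊎ y ≢ a → flipEdge X a b x y ≡ X x y
flipEdge-apart X xy≢ab xy≢ba rewrite ≟∧≟-false xy≢ab | ≟∧≟-false xy≢ba = refl

-- Restriction to induced subgraphs

restrict : AdjMat n → (Fin m → Fin n) → AdjMat m
restrict X u i j = X (u i) (u j)

module _ {u : Fin m → Fin n} (u-inj : Injective _≡_ _≡_ u) (X : AdjMat n) (p q : Fin m) where

  flipEdge-restrict : ∀ i j → restrict (flipEdge X (u p) (u q)) u i j ≡ flipEdge (restrict X u) p q i j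
  flipEdge-restrict i j
    rewrite ≟-injective u-inj i p | ≟-injective u-inj j q | ≟-injective u-inj i q | ≟-injective u-inj j p = refl

  tilde-restrict : ∀ i j → restrict (tilde X (u p) (u q)) u i j ≡ tilde (restrict X u) p q i j
  tilde-restrict i j
    rewrite ≟-injective u-inj i p | ≟-injective u-inj j q | ≟-injective u-inj i q | ≟-injective u-inj j p = refl

det-restrict-tilde : (A : AdjMat n) {a b : Fin n} → A a b ≡ A b a → A b b ≡ false → a ≢ b →
  {u : Fin m → Fin n} → Injective _≡_ _≡_ u → {p q : Fin m} → u p ≡ a → u q ≡ b →
  det (restrict (tilde A a b) u) ≡ det (restrict A u)
det-restrict-tilde A Aab≡Aba Abb≡0 a≢b {u} u-inj {p} {q} refl refl =
  trans (det-cong (tilde-restrict u-inj A p q)) (det-tilde (restrict A u) Aab≡Aba Abb≡0 (a≢b ∘ cong u))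

det-restrict-tildeFlip : (A : AdjMat n) {a b : Fin n} → A a b ≡ A b a → A b b ≡ false → a ≢ b →
  {u : Fin m → Fin n} → Injective _≡_ _≡_ u → {p q : Fin m} → u p ≡ a → u q ≡ b →
  det (restrict (tildeFlip A a b) u) ≡ det (restrict (flipEdge A a b) u)
det-restrict-tildeFlip A {a} {b} Aab≡Aba Abb≡0 a≢b {u} u-inj {p} {q} refl refl = begin
  det (restrict (flipEdge (tilde A a b) a b) u)
    ≡⟨ det-cong (λ i j → trans (flipEdge-restrict u-inj (tilde A a b) p q i j)
                               (flipEdge-cong p q (tilde-restrict u-inj A p q) i j)) ⟩
  det (tildeFlip (restrict A u) p q)
    ≡⟨ det-tildeFlip (restrict A u) Aab≡Aba Abb≡0 (a≢b ∘ cong u) ⟩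
  det (flipEdge (restrict A u) p q)
    ≡⟨ det-cong (flipEdge-restrict u-inj A p q) ⟨
  det (restrict (flipEdge A a b) u)
    ∎
  where open ≡-Reasoning

restrict-flipEdge-avoiding : (X : AdjMat n) {a b : Fin n} {u : Fin m → Fin n} →
  (∀ i → u i ≢ a) ⊎ (∀ i → u i ≢ b) → ∀ i j → restrict (flipEdge X a b) u i j ≡ restrict X u i j
restrict-flipEdge-avoiding X (inj₁ u≢a) i j = flipEdge-apart X (inj₁ (u≢a i)) (inj₂ (u≢a j))
restrict-flipEdge-avoiding X (inj₂ u≢b) i j = flipEdge-apart X (inj₂ (u≢b j)) (inj₁ (u≢b i))

lookup-injective : {A : Set} {xs : List A} → Unique xs → Injective _≡_ _≡_ (lookup xs)
lookup-injective {xs = x ∷ xs} (x∉xs ∷ xs!) {0F}    {0F}    _ = refl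
lookup-injective {xs = x ∷ xs} (x∉xs ∷ xs!) {0F}    {suc j} x≡xsⱼ = ⊥-elim (All.lookup x∉xs (∈-lookup j) x≡xsⱼ)
lookup-injective {xs = x ∷ xs} (x∉xs ∷ xs!) {suc i} {0F}    xsᵢ≡x = ⊥-elim (All.lookup x∉xs (∈-lookup i) (sym xsᵢ≡x))
lookup-injective {xs = x ∷ xs} (x∉xs ∷ xs!) {suc i} {suc j} xsᵢ≡xsⱼ = cong suc (lookup-injective xs! xsᵢ≡xsⱼ)

∉⇒lookup≢ : {A : Set} {xs : List A} {x : A} → x ∉ xs → ∀ i → lookup xs i ≢ x
∉⇒lookup≢ {xs = xs} x∉xs i xsᵢ≡x = x∉xs (subst (_∈ xs) xsᵢ≡x (∈-lookup i))

members-unique : (U : Subset n) → Unique (members U)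
members-unique []          = []
members-unique (true ∷ U)  = All.map⁺ (All.universal (λ _ ()) _) ∷ Unique.map⁺ suc-injective (members-unique U)
members-unique (false ∷ U) = Unique.map⁺ suc-injective (members-unique U)

-- The four-term relation for ν and for q_k

ν-det : (X Y : AdjMat n) (U : Subset n) → det (induced X U) ≡ det (induced Y U) → ν X U ≡ ν Y U
ν-det X Y U = cong (λ d → if d then 1 else 0)

FourTerm : AdjMat n → Fin n → Fin n → Subset n → Set
FourTerm A a b U = ν A U + ν (tildeFlip A a b) U ≡ ν (flipEdge A a b) U + ν (tilde A a b) U

ν-fourTerm-avoiding : (A : AdjMat n) {a b : Fin n} (U : Subset n) → a ∉ members U ⊎ b ∉ members U →
  FourTerm A a b U
ν-fourTerm-avoiding A {a} {b} U a∉U⊎b∉U =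
  cong₂ _+_ (sym (ν-det (flipEdge A a b) A U (det-cong (restrict-flipEdge-avoiding A u≢ab))))
            (ν-det (tildeFlip A a b) (tilde A a b) U (det-cong (restrict-flipEdge-avoiding (tilde A a b) u≢ab)))
  where
  u≢ab : (∀ i → lookup (members U) i ≢ a) ⊎ (∀ i → lookup (members U) i ≢ b)
  u≢ab = Sum.map ∉⇒lookup≢ ∉⇒lookup≢ a∉U⊎b∉U

ν-fourTerm-containing : (A : AdjMat n) {a b : Fin n} → A a b ≡ A b a → A b b ≡ false → a ≢ b →
  (U : Subset n) → a ∈ members U → b ∈ members U → FourTerm A a b U
ν-fourTerm-containing A {a} {b} Aab≡Aba Abb≡0 a≢b U a∈U b∈U = begin
  ν A U + ν (tildeFlip A a b) U
    ≡⟨ cong₂ _+_ (sym (ν-det (tilde A a b) A U (det-restrict-tilde A Aab≡Aba Abb≡0 a≢b u-inj (uᵢ≡ a∈U) (uᵢ≡ b∈U))))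
                 (ν-det (tildeFlip A a b) (flipEdge A a b) U
                   (det-restrict-tildeFlip A Aab≡Aba Abb≡0 a≢b u-inj (uᵢ≡ a∈U) (uᵢ≡ b∈U))) ⟩
  ν (tilde A a b) U + ν (flipEdge A a b) U
    ≡⟨ +-comm (ν (tilde A a b) U) _ ⟩
  ν (flipEdge A a b) U + ν (tilde A a b) U
    ∎
  where
  open ≡-Reasoning
  u-inj : Injective _≡_ _≡_ (lookup (members U))
  u-inj = lookup-injective (members-unique U)
  uᵢ≡ : ∀ {c} (c∈U : c ∈ members U) → lookup (members U) (index c∈U) ≡ c
  uᵢ≡ c∈U = sym (lookup-index c∈U)

ν-fourTerm : (A : AdjMat n) {a b : Fin n} → A a b ≡ A b a → A b b ≡ false → a ≢ b →
  (U : Subset n) → FourTerm A a b U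
ν-fourTerm A {a} {b} Aab≡Aba Abb≡0 a≢b U with any? (a ≟_) (members U) | any? (b ≟_) (members U)
... | yes a∈U | yes b∈U = ν-fourTerm-containing A Aab≡Aba Abb≡0 a≢b U a∈U b∈U
... | no a∉U  | _       = ν-fourTerm-avoiding A U (inj₁ a∉U)
... | _       | no b∉U  = ν-fourTerm-avoiding A U (inj₂ b∉U)

sum-map-+ : {X : Set} (f g : X → ℕ) (xs : List X) →
  sum (map f xs) + sum (map g xs) ≡ sum (map (λ x → f x + g x) xs)
sum-map-+ f g []       = refl
sum-map-+ f g (x ∷ xs) =
  trans (ℕ+Properties.interchange (f x) (sum (map f xs)) (g x) (sum (map g xs)))
        (cong (_+_ (f x + g x)) (sum-map-+ f g xs))

q-fourTerm : (A : AdjMat n) {a b : Fin n} → A a b ≡ A b a → A b b ≡ false → a ≢ b → ∀ k →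
  q A k + q (tildeFlip A a b) k ≡ q (flipEdge A a b) k + q (tilde A a b) k
q-fourTerm {n} A {a} {b} Aab≡Aba Abb≡0 a≢b k = begin
  q A k + q (tildeFlip A a b) k
    ≡⟨ sum-map-+ (ν-of-size A) (ν-of-size (tildeFlip A a b)) (allSubsets n) ⟩
  sum (map (λ U → ν-of-size A U + ν-of-size (tildeFlip A a b) U) (allSubsets n))
    ≡⟨ cong sum (map-cong fourTerm-of-size (allSubsets n)) ⟩
  sum (map (λ U → ν-of-size (flipEdge A a b) U + ν-of-size (tilde A a b) U) (allSubsets n))
    ≡⟨ sum-map-+ (ν-of-size (flipEdge A a b)) (ν-of-size (tilde A a b)) (allSubsets n) ⟨
  q (flipEdge A a b) k + q (tilde A a b) k
    ∎
  where
  open ≡-Reasoning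
  ν-of-size : AdjMat n → Subset n → ℕ
  ν-of-size X U = if ∣ U ∣ ≡ᵇ k then ν X U else 0
  fourTerm-of-size : ∀ U → ν-of-size A U + ν-of-size (tildeFlip A a b) U
                         ≡ ν-of-size (flipEdge A a b) U + ν-of-size (tilde A a b) U
  fourTerm-of-size U with ∣ U ∣ ≡ᵇ k
  ... | true  = ν-fourTerm A Aab≡Aba Abb≡0 a≢b U
  ... | false = refl

⊖-cross : ∀ {w x y z} → w + z ≡ x + y → w ⊖ x ≡ y ⊖ z
⊖-cross {w} {x} {y} {z} w+z≡x+y = begin
  w ⊖ x              ≡⟨ +-cancelˡ-⊖ z w x ⟨
  (z + w) ⊖ (z + x)  ≡⟨ cong₂ _⊖_ (trans (+-comm z w) w+z≡x+y) (+-comm z x) ⟩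
  (x + y) ⊖ (x + z)  ≡⟨ +-cancelˡ-⊖ x y z ⟩
  y ⊖ z              ∎
  where open ≡-Reasoning

mainTheorem9 : (n : ℕ) (A : AdjMat n) →
    (∀ x y → A x y ≡ A y x) → (∀ x → A x x ≡ false) →
    (a b : Fin n) → a ≢ b →
    ∀ j → Qcoeff A j - Qcoeff (flipEdge A a b) j
          ≡ Qcoeff (tilde A a b) j - Qcoeff (tildeFlip A a b) j
mainTheorem9 n A A-sym A-irrefl a b a≢b j with j ≤ᵇ n
... | false = refl
... | true  = begin
  + q A k - + q (flipEdge A a b) k
    ≡⟨ [+m]-[+n]≡m⊖n (q A k) (q (flipEdge A a b) k) ⟩
  q A k ⊖ q (flipEdge A a b) k
    ≡⟨ ⊖-cross {w = q A k} (q-fourTerm A (A-sym a b) (A-irrefl b) a≢b k) ⟩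
  q (tilde A a b) k ⊖ q (tildeFlip A a b) k
    ≡⟨ [+m]-[+n]≡m⊖n (q (tilde A a b) k) (q (tildeFlip A a b) k) ⟨
  + q (tilde A a b) k - + q (tildeFlip A a b) k
    ∎
  where
  open ≡-Reasoning
  k = n ∸ j
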